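{- Let $p$ be a prime and $k\ge 1$ an integer. Let $M(p^k)$ be the number of quadruples $(a,b,c,d)$ of integers with $1\le a,b,c,d\le p^k$, $\gcd(abcd,p^k)=1$, $a+b+c+d\equiv 0\pmod p$ and $abc+abd+acd+bcd\equiv 0\pmod p$. Then \[ M(p^k)=\begin{cases} 2^{4(k-1)}, &\text{if }p=2,\\ 3p^{4(k-1)}(p-1)(p-2), &\text{if }p\ge 3. \end{cases} \] -}

module Defs where

open import Data.Nat using (ℕ; suc; _+_; _*_; _^_; _≟_; NonZero)
open import Data.Nat.DivMod using (_%_)
open import Data.Nat.GCD using (gcd)
open import Data.List using (List; length; filter; map; concatMap)
open import Data.List.Base using (upTo)
open import Data.Product using (_×_; _,_)
open import Relation.Nullary using (Dec)
open import Relation.Nullary.Decidable using (_×-dec_)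
open import Relation.Binary.PropositionalEquality using (_≡_)

range1 : ℕ → List ℕ
range1 N = map suc (upTo N)

Quad : Set
Quad = ℕ × ℕ × ℕ × ℕ

quads : ℕ → List Quad
quads N = concatMap (λ a → concatMap (λ b → concatMap (λ c → map (λ d → (a , b , c , d)) (range1 N)) (range1 N)) (range1 N)) (range1 N)

Cond : (p k : ℕ) .{{_ : NonZero p}} → Quad → Set
Cond p k (a , b , c , d) =
  (gcd (a * b * c * d) (p ^ k) ≡ 1) ×
  (((a + b + c + d) % p ≡ 0) ×
   ((a * b * c + a * b * d + a * c * d + b * c * d) % p ≡ 0))

cond? : (p k : ℕ) .{{_ : NonZero p}} → (q : Quad) → Dec (Cond p k q)
cond? p k (a , b , c , d) =
  (gcd (a * b * c * d) (p ^ k) ≟ 1) ×-dec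
  (((a + b + c + d) % p ≟ 0) ×-dec
   ((a * b * c + a * b * d + a * c * d + b * c * d) % p ≟ 0))

M : (p k : ℕ) .{{_ : NonZero p}} → ℕ
M p k = length (filter (cond? p k) (quads (p ^ k)))

-- The condition only sees residues mod p (gcd(abcd, p^k) = 1 just says p ∤ abcd), and every
-- residue occurs p^(k-1) times in 1..p^k, so M(p^k) = p^(4(k-1)) M(p).  Modulo p the first
-- congruence forces d ≡ -(a+b+c), and then
--   e₃(a,b,c,d) + (a+b)(a+c)(b+c) = (ab+ac+bc)(a+b+c+d)
-- turns the second one into p ∣ (a+b)(a+c)(b+c).  For fixed nonzero a and b the number of
-- admissible c is p-1 if b ≡ -a (any c ≢ 0), and otherwise the number of distinct residues
-- among -a, -b: 1 if b ≡ a, 2 if not.  For odd p, a ≢ -a, so the sum over b is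
-- (p-1) + 1 + 2(p-3) = 3(p-2), giving M(p) = 3(p-1)(p-2).  For p = 2 only (1,1,1,1) survives.

module Submission where

open import Defs
open import Level using (Level)
open import Data.Nat using (ℕ; zero; suc; _+_; _*_; _^_; _∸_; _≤_; _<_; _≥_; z≤n; s≤s; z<s; s<s; NonZero; >-nonZero⁻¹; nonTrivial⇒≢1; _≟_)
open import Data.Nat.Properties
open import Algebra.Properties.CommutativeSemigroup +-commutativeSemigroup using () renaming (interchange to +-interchange)
open import Data.Nat.DivMod using (_%_; m%n<n; m<n⇒m%n≡m; m%n%n≡m%n; m*n%n≡0; %-remove-+ˡ; %-distribˡ-+; %-distribˡ-*)
open import Data.Nat.Divisibility
open import Data.Nat.Coprimality using (Coprime; coprime-divisor; coprime⇒gcd≡1; gcd≡1⇒coprime)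
open import Data.Nat.GCD using (gcd)
open import Data.Nat.Primality using (Prime; prime⇒nonZero; prime⇒nonTrivial; prime⇒irreducible; euclidsLemma)
open import Data.Nat.Tactic.RingSolver using (solve-∀)
open import Data.Nat.ListAction using (sum)
open import Data.Nat.ListAction.Properties using (sum-++)
open import Data.List using (List; []; _∷_; _++_; map; concatMap; applyUpTo; upTo; length; filter)
open import Data.List.Properties using (map-++; map-∘)
open import Data.Product using (_×_; _,_; proj₁; proj₂; ∃-syntax)
open import Data.Sum using (_⊎_; inj₁; inj₂; [_,_]; reduce)
open import Function using (_∘_; _⇔_; mk⇔; Equivalence)
open import Function.Construct.Composition using (_⇔-∘_)
open import Function.Related.TypeIsomorphisms using (¬-cong-⇔)
open import Data.Product.Function.NonDependent.Propositional using (_×-⇔_)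
open import Relation.Nullary using (Dec; yes; no; ¬_; contradiction)
open import Relation.Nullary.Decidable using (_×-dec_; _⊎-dec_; ¬?)
open import Relation.Unary using (Pred; Decidable)
open import Relation.Binary.PropositionalEquality using (_≡_; _≢_; refl; sym; trans; cong; cong₂; subst; module ≡-Reasoning)

open Equivalence using (to; from)

private variable
  ℓ ℓ′ : Level
  P : Set ℓ
  Q : Set ℓ′

𝟙 : Dec P → ℕ
𝟙 (yes _) = 1
𝟙 (no _)  = 0

𝟙-yes : (P? : Dec P) → P → 𝟙 P? ≡ 1
𝟙-yes (yes _) _  = refl
𝟙-yes (no ¬p) p  = contradiction p ¬p

𝟙-no : (P? : Dec P) → ¬ P → 𝟙 P? ≡ 0
𝟙-no (yes p) ¬p = contradiction p ¬p
𝟙-no (no _)  _  = refl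

𝟙-cong : (P? : Dec P) (Q? : Dec Q) → P ⇔ Q → 𝟙 P? ≡ 𝟙 Q?
𝟙-cong (yes p) Q? P⇔Q = sym (𝟙-yes Q? (to P⇔Q p))
𝟙-cong (no ¬p) Q? P⇔Q = sym (𝟙-no Q? (¬p ∘ from P⇔Q))

𝟙-× : (P? : Dec P) (Q? : Dec Q) → 𝟙 (P? ×-dec Q?) ≡ 𝟙 P? * 𝟙 Q?
𝟙-× (yes _) (yes _) = refl
𝟙-× (yes _) (no _)  = refl
𝟙-× (no _)  _       = refl

𝟙-⊎ : (P? : Dec P) (Q? : Dec Q) → ¬ (P × Q) → 𝟙 (P? ⊎-dec Q?) ≡ 𝟙 P? + 𝟙 Q?
𝟙-⊎ (yes p) (yes q) ¬pq = contradiction (p , q) ¬pq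
𝟙-⊎ (yes _) (no _)  _   = refl
𝟙-⊎ (no _)  (yes _) _   = refl
𝟙-⊎ (no _)  (no _)  _   = refl

𝟙-¬ : (P? : Dec P) → 𝟙 (¬? P?) + 𝟙 P? ≡ 1
𝟙-¬ (yes _) = refl
𝟙-¬ (no _)  = refl

∑< : ℕ → (ℕ → ℕ) → ℕ
∑< zero    f = 0
∑< (suc n) f = f 0 + ∑< n (f ∘ suc)

syntax ∑< n (λ x → e) = ∑[ x < n ] e

∑-cong : ∀ n {f g : ℕ → ℕ} → (∀ x → x < n → f x ≡ g x) → ∑< n f ≡ ∑< n g
∑-cong zero    f≡g = refl
∑-cong (suc n) f≡g = cong₂ _+_ (f≡g 0 z<s) (∑-cong n (λ x x<n → f≡g (suc x) (s<s x<n)))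

∑-distrib-+ : ∀ n (f g : ℕ → ℕ) → ∑[ x < n ] (f x + g x) ≡ ∑< n f + ∑< n g
∑-distrib-+ zero    f g = refl
∑-distrib-+ (suc n) f g =
  trans (cong (f 0 + g 0 +_) (∑-distrib-+ n (f ∘ suc) (g ∘ suc))) (+-interchange (f 0) (g 0) _ _)

*-distribˡ-∑ : ∀ n m (f : ℕ → ℕ) → ∑[ x < n ] (m * f x) ≡ m * ∑< n f
*-distribˡ-∑ zero    m f = sym (*-zeroʳ m)
*-distribˡ-∑ (suc n) m f = trans (cong (m * f 0 +_) (*-distribˡ-∑ n m (f ∘ suc))) (sym (*-distribˡ-+ m (f 0) _))

∑-const : ∀ n c → ∑[ _ < n ] c ≡ n * c
∑-const zero    c = refl
∑-const (suc n) c = cong (c +_) (∑-const n c)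

∑-0 : ∀ n → ∑[ _ < n ] 0 ≡ 0
∑-0 n = trans (∑-const n 0) (*-zeroʳ n)

∑-split : ∀ m n (f : ℕ → ℕ) → ∑< (m + n) f ≡ ∑< m f + ∑[ x < n ] f (m + x)
∑-split zero    n f = refl
∑-split (suc m) n f = trans (cong (f 0 +_) (∑-split m n (f ∘ suc))) (sym (+-assoc (f 0) _ _))

∑-snoc : ∀ n (f : ℕ → ℕ) → ∑< (suc n) f ≡ ∑< n f + f n
∑-snoc zero    f = +-comm (f 0) 0
∑-snoc (suc n) f = trans (cong (f 0 +_) (∑-snoc n (f ∘ suc))) (sym (+-assoc (f 0) _ _))

∑-rotate : ∀ n (f : ℕ → ℕ) → f n ≡ f 0 → ∑[ x < n ] f (suc x) ≡ ∑< n f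
∑-rotate n f fn≡f0 = +-cancelʳ-≡ (f 0) _ _ (begin
  ∑< n (f ∘ suc) + f 0 ≡⟨ +-comm _ (f 0) ⟩
  ∑< (suc n) f         ≡⟨ ∑-snoc n f ⟩
  ∑< n f + f n         ≡⟨ cong (∑< n f +_) fn≡f0 ⟩
  ∑< n f + f 0         ∎)
  where open ≡-Reasoning

∑-single : ∀ n t (f : ℕ → ℕ) → t < n → (∀ x → x < n → x ≢ t → f x ≡ 0) → ∑< n f ≡ f t
∑-single (suc n) zero f _ f≡0 = begin
  f 0 + ∑< n (f ∘ suc)  ≡⟨ cong (f 0 +_) (∑-cong n (λ x x<n → f≡0 (suc x) (s<s x<n) λ ())) ⟩
  f 0 + ∑[ _ < n ] 0    ≡⟨ cong (f 0 +_) (∑-0 n) ⟩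
  f 0 + 0               ≡⟨ +-identityʳ (f 0) ⟩
  f 0                   ∎
  where open ≡-Reasoning
∑-single (suc n) (suc t) f (s<s t<n) f≡0 =
  trans (cong (_+ ∑< n (f ∘ suc)) (f≡0 0 z<s λ ()))
        (∑-single n t (f ∘ suc) t<n (λ x x<n x≢t → f≡0 (suc x) (s<s x<n) (x≢t ∘ suc-injective)))

∑-𝟙-≟ : ∀ n t → t < n → ∑[ x < n ] 𝟙 (x ≟ t) ≡ 1
∑-𝟙-≟ n t t<n = trans (∑-single n t _ t<n (λ x _ x≢t → 𝟙-no (x ≟ t) x≢t)) (𝟙-yes (t ≟ t) refl)

length-filter≡sum-𝟙 : ∀ {A : Set} {P : Pred A ℓ} (P? : Decidable P) xs →
                      length (filter P? xs) ≡ sum (map (𝟙 ∘ P?) xs)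
length-filter≡sum-𝟙 P? []       = refl
length-filter≡sum-𝟙 P? (x ∷ xs) with P? x
... | yes _ = cong suc (length-filter≡sum-𝟙 P? xs)
... | no _  = length-filter≡sum-𝟙 P? xs

sum-map-concatMap : ∀ {A B : Set} (f : B → ℕ) (g : A → List B) xs →
                    sum (map f (concatMap g xs)) ≡ sum (map (λ x → sum (map f (g x))) xs)
sum-map-concatMap f g []       = refl
sum-map-concatMap f g (x ∷ xs) = begin
  sum (map f (g x ++ concatMap g xs))          ≡⟨ cong sum (map-++ f (g x) _) ⟩
  sum (map f (g x) ++ map f (concatMap g xs))  ≡⟨ sum-++ (map f (g x)) _ ⟩
  sum (map f (g x)) + sum (map f (concatMap g xs))       ≡⟨ cong (sum (map f (g x)) +_) (sum-map-concatMap f g xs) ⟩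
  sum (map f (g x)) + sum (map (λ y → sum (map f (g y))) xs) ∎
  where open ≡-Reasoning

sum-map-applyUpTo : ∀ (f g : ℕ → ℕ) n → sum (map f (applyUpTo g n)) ≡ ∑[ x < n ] f (g x)
sum-map-applyUpTo f g zero    = refl
sum-map-applyUpTo f g (suc n) = cong (f (g 0) +_) (sum-map-applyUpTo f (g ∘ suc) n)

sum-map-range1 : ∀ N (f : ℕ → ℕ) → sum (map f (range1 N)) ≡ ∑[ x < N ] f (suc x)
sum-map-range1 N f = trans (cong sum (sym (map-∘ (upTo N)))) (sum-map-applyUpTo (f ∘ suc) (λ x → x) N)

module Periodic (p : ℕ) .{{_ : NonZero p}} where

  ∑-mod : ∀ m (g : ℕ → ℕ) → ∑[ x < m * p ] g (x % p) ≡ m * ∑< p g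
  ∑-mod zero    g = refl
  ∑-mod (suc m) g = begin
    ∑< (p + m * p) (g ∘ (_% p))                        ≡⟨ ∑-split p (m * p) (g ∘ (_% p)) ⟩
    ∑[ x < p ] g (x % p) + ∑[ x < m * p ] g ((p + x) % p) ≡⟨ cong₂ _+_ (∑-cong p (λ x x<p → cong g (m<n⇒m%n≡m x<p)))
                                                                      (∑-cong (m * p) (λ x _ → cong g (%-remove-+ˡ x ∣-refl))) ⟩
    ∑< p g + ∑[ x < m * p ] g (x % p)                  ≡⟨ cong (∑< p g +_) (∑-mod m g) ⟩
    ∑< p g + m * ∑< p g                                ∎
    where open ≡-Reasoning

  ∑-suc-mod : ∀ m (g : ℕ → ℕ) → ∑[ x < m * p ] g (suc x % p) ≡ m * ∑< p g
  ∑-suc-mod m g = trans (∑-rotate (m * p) (g ∘ (_% p)) (cong g (trans (m*n%n≡0 m p) (sym (m*n%n≡0 0 p)))))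
                        (∑-mod m g)

  sum-map-range1-periodic : ∀ m k (f g : ℕ → ℕ) → (∀ x → f x ≡ k * g (x % p)) →
                            sum (map f (range1 (m * p))) ≡ m * k * ∑< p g
  sum-map-range1-periodic m k f g f≡ = begin
    sum (map f (range1 (m * p)))       ≡⟨ sum-map-range1 (m * p) f ⟩
    ∑[ x < m * p ] f (suc x)           ≡⟨ ∑-cong (m * p) (λ x _ → f≡ (suc x)) ⟩
    ∑[ x < m * p ] (k * g (suc x % p)) ≡⟨ *-distribˡ-∑ (m * p) k (λ x → g (suc x % p)) ⟩
    k * ∑[ x < m * p ] g (suc x % p)   ≡⟨ cong (k *_) (∑-suc-mod m g) ⟩
    k * (m * ∑< p g)                   ≡⟨ *-assoc k m _ ⟨
    k * m * ∑< p g                     ≡⟨ cong (_* ∑< p g) (*-comm k m) ⟩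
    m * k * ∑< p g                     ∎
    where open ≡-Reasoning

  sum-map-quads-periodic : ∀ m (F : Quad → ℕ) (h : ℕ → ℕ → ℕ → ℕ → ℕ) →
    (∀ a b c d → F (a , b , c , d) ≡ h (a % p) (b % p) (c % p) (d % p)) →
    sum (map F (quads (m * p))) ≡ m ^ 4 * ∑[ a < p ] ∑[ b < p ] ∑[ c < p ] ∑[ d < p ] h a b c d
  sum-map-quads-periodic m F h F≡h =
    trans (sum-map-concatMap F _ R) (periodic 3 λ a →
    trans (sum-map-concatMap F _ R) (periodic 2 λ b →
    trans (sum-map-concatMap F _ R) (periodic 1 λ c →
    trans (cong sum (sym (map-∘ R))) (periodic 0 λ d →
    trans (F≡h a b c d) (sym (*-identityˡ _))))))
    where
    R : List ℕ
    R = range1 (m * p)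
    periodic : ∀ i {f g : ℕ → ℕ} → (∀ x → f x ≡ m ^ i * g (x % p)) →
               sum (map f R) ≡ m ^ suc i * ∑< p g
    periodic i = sum-map-range1-periodic m (m ^ i) _ _

module Residues (n : ℕ) .{{_ : NonZero n}} where

  infix 4 _≈_
  _≈_ : ℕ → ℕ → Set
  x ≈ y = x % n ≡ y % n

  ≈-mod : ∀ x → x ≈ x % n
  ≈-mod x = sym (m%n%n≡m%n x n)

  ≈-+ : ∀ {x x′ y y′} → x ≈ x′ → y ≈ y′ → x + y ≈ x′ + y′
  ≈-+ {x} {x′} {y} {y′} x≈x′ y≈y′ = begin
    (x + y) % n                ≡⟨ %-distribˡ-+ x y n ⟩
    (x % n + y % n) % n        ≡⟨ cong₂ (λ u v → (u + v) % n) x≈x′ y≈y′ ⟩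
    (x′ % n + y′ % n) % n      ≡⟨ %-distribˡ-+ x′ y′ n ⟨
    (x′ + y′) % n              ∎
    where open ≡-Reasoning

  ≈-* : ∀ {x x′ y y′} → x ≈ x′ → y ≈ y′ → x * y ≈ x′ * y′
  ≈-* {x} {x′} {y} {y′} x≈x′ y≈y′ = begin
    (x * y) % n                ≡⟨ %-distribˡ-* x y n ⟩
    (x % n * (y % n)) % n      ≡⟨ cong₂ (λ u v → (u * v) % n) x≈x′ y≈y′ ⟩
    (x′ % n * (y′ % n)) % n    ≡⟨ %-distribˡ-* x′ y′ n ⟨
    (x′ * y′) % n              ∎
    where open ≡-Reasoning

  ∣⇔≈0 : ∀ {x} → n ∣ x ⇔ x ≈ 0
  ∣⇔≈0 {x} = mk⇔ (λ n∣x → trans (n∣m⇒m%n≡0 x n n∣x) (sym 0%n))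
                 (λ x≈0 → m%n≡0⇒n∣m x n (trans x≈0 0%n))
    where
    0%n : 0 % n ≡ 0
    0%n = m*n%n≡0 0 n

  ∣-cong-≈ : ∀ {x y} → x ≈ y → n ∣ x ⇔ n ∣ y
  ∣-cong-≈ x≈y = mk⇔ (λ n∣x → from ∣⇔≈0 (trans (sym x≈y) (to ∣⇔≈0 n∣x)))
                     (λ n∣y → from ∣⇔≈0 (trans x≈y (to ∣⇔≈0 n∣y)))

  ≈⇒≡ : ∀ {x y} → x < n → y < n → x ≈ y → x ≡ y
  ≈⇒≡ x<n y<n x≈y = trans (sym (m<n⇒m%n≡m x<n)) (trans x≈y (m<n⇒m%n≡m y<n))

  neg : ℕ → ℕ
  neg s = n ∸ s % n

  +-neg≈0 : ∀ s → s + neg s ≈ 0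
  +-neg≈0 s = begin
    (s + neg s) % n         ≡⟨ ≈-+ (≈-mod s) refl ⟩
    (s % n + neg s) % n     ≡⟨ cong (_% n) (m+[n∸m]≡n (<⇒≤ (m%n<n s n))) ⟩
    n % n                   ≡⟨ to ∣⇔≈0 ∣-refl ⟩
    0 % n                   ∎
    where open ≡-Reasoning

  ∣+⇒≈neg : ∀ {s x} → n ∣ s + x → x ≈ neg s
  ∣+⇒≈neg {s} {x} n∣s+x = begin
    x % n                    ≡⟨ cong (_% n) (+-identityʳ x) ⟨
    (x + 0) % n              ≡⟨ ≈-+ {x} refl (+-neg≈0 s) ⟨
    (x + (s + neg s)) % n    ≡⟨ cong (_% n) (trans (sym (+-assoc x s (neg s))) (cong (_+ neg s) (+-comm x s))) ⟩
    (s + x + neg s) % n      ≡⟨ ≈-+ (to ∣⇔≈0 n∣s+x) refl ⟩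
    neg s % n                ∎
    where open ≡-Reasoning

  ∣+-unique : ∀ {s x y} → x < n → y < n → n ∣ s + x → n ∣ s + y → x ≡ y
  ∣+-unique x<n y<n n∣s+x n∣s+y = ≈⇒≡ x<n y<n (trans (∣+⇒≈neg n∣s+x) (sym (∣+⇒≈neg n∣s+y)))

  ∣+-solution : ∀ s → ∃[ d ] d < n × n ∣ s + d
  ∣+-solution s = neg s % n , m%n<n (neg s) n ,
    from ∣⇔≈0 (trans (≈-+ {s} refl (sym (≈-mod (neg s)))) (+-neg≈0 s))

  ∑-𝟙-∣+ : ∀ s → ∑[ x < n ] 𝟙 (n ∣? s + x) ≡ 1
  ∑-𝟙-∣+ s with ∣+-solution s
  ... | d , d<n , n∣s+d = trans
    (∑-cong n (λ x x<n → 𝟙-cong (n ∣? s + x) (x ≟ d)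
      (mk⇔ (λ n∣s+x → ∣+-unique x<n d<n n∣s+x n∣s+d) (λ { refl → n∣s+d }))))
    (∑-𝟙-≟ n d d<n)

∣m+n⇒∣m⇔∣n : ∀ {d m n} → d ∣ m + n → d ∣ m ⇔ d ∣ n
∣m+n⇒∣m⇔∣n {d} {m} {n} d∣m+n =
  mk⇔ (∣m+n∣m⇒∣n d∣m+n) (∣m+n∣m⇒∣n (subst (d ∣_) (+-comm m n) d∣m+n))

∣m⇒∣m+n⇔∣n : ∀ {d m n} → d ∣ m → d ∣ m + n ⇔ d ∣ n
∣m⇒∣m+n⇔∣n d∣m = mk⇔ (λ d∣m+n → ∣m+n∣m⇒∣n d∣m+n d∣m) (∣m∣n⇒∣m+n d∣m)

coprime-*ʳ : ∀ {m n o} → Coprime m n → Coprime m o → Coprime m (n * o)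
coprime-*ʳ {m} {n} m⊥n m⊥o {d} (d∣m , d∣n*o) = m⊥o (d∣m , coprime-divisor d⊥n d∣n*o)
  where
  d⊥n : Coprime d n
  d⊥n (e∣d , e∣n) = m⊥n (∣-trans e∣d d∣m , e∣n)

coprime-^ʳ : ∀ {m n} → Coprime m n → ∀ k → Coprime m (n ^ k)
coprime-^ʳ m⊥n zero    (_ , d∣1) = ∣1⇒≡1 d∣1
coprime-^ʳ m⊥n (suc k) = coprime-*ʳ m⊥n (coprime-^ʳ m⊥n k)

e₃+π≡σ₂*σ₁ : ∀ a b c d →
  (a * b * c + a * b * d + a * c * d + b * c * d) + (a + b) * (a + c) * (b + c) ≡
  (a * b + a * c + b * c) * (a + b + c + d)
e₃+π≡σ₂*σ₁ = solve-∀

first-summand : ∀ {x y u v w r} → x ≡ y → y + u + v + w ≡ r → x + u + v + w ≡ r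
first-summand {u = u} {v} {w} x≡y = trans (cong (λ m → m + u + v + w) x≡y)

2≡2+x*0 : ∀ x → 2 ≡ 2 + x * 0
2≡2+x*0 x = cong (2 +_) (sym (*-zeroʳ x))

x+0+2*0+2*1≡2+x*1 : ∀ x → x + 0 + 2 * 0 + 2 * 1 ≡ 2 + x * 1
x+0+2*0+2*1≡2+x*1 = solve-∀

balance-arith : ∀ n S → 2 ≤ n → S + 1 + 2 * 1 + 2 * 1 ≡ n * 2 + (n ∸ 1) * 1 → S ≡ 3 * (n ∸ 2)
balance-arith zero          S ()               _
balance-arith (suc zero)    S (s≤s ())         _
balance-arith (suc (suc q)) S _ eq = +-cancelʳ-≡ 5 S (3 * q) (trans (S+5≡ S) (trans eq (≡3q+5 q)))
  where
  S+5≡ : ∀ S → S + 5 ≡ S + 1 + 2 * 1 + 2 * 1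
  S+5≡ = solve-∀
  ≡3q+5 : ∀ q → (2 + q) * 2 + (1 + q) * 1 ≡ 3 * q + 5
  ≡3q+5 = solve-∀

module Conditions (p : ℕ) where

  e₃ : ℕ → ℕ → ℕ → ℕ → ℕ
  e₃ a b c d = a * b * c + a * b * d + a * c * d + b * c * d

  Good₄ : ℕ → ℕ → ℕ → ℕ → Set
  Good₄ a b c d = ¬ p ∣ a * b * c * d × p ∣ a + b + c + d × p ∣ e₃ a b c d

  good₄? : ∀ a b c d → Dec (Good₄ a b c d)
  good₄? a b c d = ¬? (p ∣? a * b * c * d) ×-dec p ∣? a + b + c + d ×-dec p ∣? e₃ a b c d

  -- What remains of Good₄ once d ≡ -(a+b+c) is substituted.
  Good₃ : ℕ → ℕ → ℕ → Set
  Good₃ a b c = ¬ p ∣ a * b * c × ¬ p ∣ a + b + c × p ∣ (a + b) * (a + c) * (b + c)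

  good₃? : ∀ a b c → Dec (Good₃ a b c)
  good₃? a b c = ¬? (p ∣? a * b * c) ×-dec ¬? (p ∣? a + b + c) ×-dec p ∣? (a + b) * (a + c) * (b + c)

  residueCount : ℕ
  residueCount = ∑[ a < p ] ∑[ b < p ] ∑[ c < p ] ∑[ d < p ] 𝟙 (good₄? a b c d)

  completions : ℕ → ℕ → ℕ
  completions a b = ∑[ c < p ] 𝟙 (good₃? a b c)

residueCount[2]≡1 : Conditions.residueCount 2 ≡ 1
residueCount[2]≡1 = refl

module _ {p : ℕ} (prime : Prime p) where

  private instance
    p-nonZero : NonZero p
    p-nonZero = prime⇒nonZero prime

  open Conditions p
  open Residues p
  open Periodic p

  ¬∣⇒coprime : ∀ {x} → ¬ p ∣ x → Coprime x p
  ¬∣⇒coprime ¬p∣x {i} (i∣x , i∣p) with prime⇒irreducible prime i∣p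
  ... | inj₁ i≡1  = i≡1
  ... | inj₂ refl = contradiction i∣x ¬p∣x

  gcd[x,p^suc-k]≡1⇔¬∣ : ∀ {x} k → gcd x (p ^ suc k) ≡ 1 ⇔ (¬ p ∣ x)
  gcd[x,p^suc-k]≡1⇔¬∣ k = mk⇔
    (λ gcd≡1 p∣x → nonTrivial⇒≢1 {{prime⇒nonTrivial prime}} (gcd≡1⇒coprime gcd≡1 (p∣x , m∣m*n (p ^ k))))
    (λ ¬p∣x → coprime⇒gcd≡1 (coprime-^ʳ (¬∣⇒coprime ¬p∣x) (suc k)))

  ¬∣*⇔ : ∀ {x y} → (¬ p ∣ x * y) ⇔ (¬ p ∣ x × ¬ p ∣ y)
  ¬∣*⇔ {x} {y} = mk⇔
    (λ ¬p∣xy → ¬p∣xy ∘ ∣m⇒∣m*n y , ¬p∣xy ∘ ∣n⇒∣m*n x)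
    (λ (¬p∣x , ¬p∣y) → [ ¬p∣x , ¬p∣y ] ∘ euclidsLemma x y prime)

  cond⇔good₄ : ∀ k a b c d → Cond p (suc k) (a , b , c , d) ⇔ Good₄ (a % p) (b % p) (c % p) (d % p)
  cond⇔good₄ k a b c d =
    (¬-cong-⇔ (∣-cong-≈ product) ⇔-∘ gcd[x,p^suc-k]≡1⇔¬∣ k) ×-⇔
    (∣-cong-≈ total ⇔-∘ m%n≡0⇔n∣m _ p) ×-⇔
    (∣-cong-≈ e₃≈ ⇔-∘ m%n≡0⇔n∣m _ p)
    where
    ra : a ≈ a % p
    ra = ≈-mod a
    rb : b ≈ b % p
    rb = ≈-mod b
    rc : c ≈ c % p
    rc = ≈-mod c
    rd : d ≈ d % p
    rd = ≈-mod d
    product : a * b * c * d ≈ (a % p) * (b % p) * (c % p) * (d % p)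
    product = ≈-* (≈-* (≈-* ra rb) rc) rd
    total : a + b + c + d ≈ (a % p) + (b % p) + (c % p) + (d % p)
    total = ≈-+ (≈-+ (≈-+ ra rb) rc) rd
    e₃≈ : e₃ a b c d ≈ e₃ (a % p) (b % p) (c % p) (d % p)
    e₃≈ = ≈-+ (≈-+ (≈-+ (≈-* (≈-* ra rb) rc) (≈-* (≈-* ra rb) rd)) (≈-* (≈-* ra rc) rd)) (≈-* (≈-* rb rc) rd)

  good₄⇔ : ∀ a b c d → Good₄ a b c d ⇔ (Good₃ a b c × p ∣ a + b + c + d)
  good₄⇔ a b c d = mk⇔
    (λ (¬p∣abcd , p∣s+d , p∣e₃) → let (¬p∣abc , ¬p∣d) = to ¬∣*⇔ ¬p∣abcd in
      (¬p∣abc , ¬p∣d ∘ to (s⇔d p∣s+d) , to (e₃⇔π p∣s+d) p∣e₃) , p∣s+d)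
    (λ ((¬p∣abc , ¬p∣s , p∣π) , p∣s+d) →
      from ¬∣*⇔ (¬p∣abc , ¬p∣s ∘ from (s⇔d p∣s+d)) , p∣s+d , from (e₃⇔π p∣s+d) p∣π)
    where
    s⇔d : p ∣ a + b + c + d → p ∣ a + b + c ⇔ p ∣ d
    s⇔d = ∣m+n⇒∣m⇔∣n
    e₃⇔π : p ∣ a + b + c + d → p ∣ e₃ a b c d ⇔ p ∣ (a + b) * (a + c) * (b + c)
    e₃⇔π p∣σ₁ = ∣m+n⇒∣m⇔∣n (subst (p ∣_) (sym (e₃+π≡σ₂*σ₁ a b c d)) (∣n⇒∣m*n (a * b + a * c + b * c) p∣σ₁))

  ∑-good₄ : ∀ a b c → ∑[ d < p ] 𝟙 (good₄? a b c d) ≡ 𝟙 (good₃? a b c)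
  ∑-good₄ a b c = begin
    ∑[ d < p ] 𝟙 (good₄? a b c d)                              ≡⟨ ∑-cong p (λ d _ → trans
                                                                    (𝟙-cong (good₄? a b c d) _ (good₄⇔ a b c d))
                                                                    (𝟙-× (good₃? a b c) (p ∣? a + b + c + d))) ⟩
    ∑[ d < p ] (𝟙 (good₃? a b c) * 𝟙 (p ∣? a + b + c + d))     ≡⟨ *-distribˡ-∑ p (𝟙 (good₃? a b c)) (λ d → 𝟙 (p ∣? a + b + c + d)) ⟩
    𝟙 (good₃? a b c) * ∑[ d < p ] 𝟙 (p ∣? a + b + c + d)       ≡⟨ cong (𝟙 (good₃? a b c) *_) (∑-𝟙-∣+ (a + b + c)) ⟩
    𝟙 (good₃? a b c) * 1                                       ≡⟨ *-identityʳ _ ⟩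
    𝟙 (good₃? a b c)                                           ∎
    where open ≡-Reasoning

  ∑-¬∣ : ∑[ x < p ] 𝟙 (¬? (p ∣? x)) ≡ p ∸ 1
  ∑-¬∣ = +-cancelʳ-≡ 1 _ _ (begin
    ∑[ x < p ] 𝟙 (¬? (p ∣? x)) + 1                        ≡⟨ cong (∑[ x < p ] 𝟙 (¬? (p ∣? x)) +_) (∑-𝟙-∣+ 0) ⟨
    ∑[ x < p ] 𝟙 (¬? (p ∣? x)) + ∑[ x < p ] 𝟙 (p ∣? x)   ≡⟨ ∑-distrib-+ p (λ x → 𝟙 (¬? (p ∣? x))) (λ x → 𝟙 (p ∣? x)) ⟨
    ∑[ x < p ] (𝟙 (¬? (p ∣? x)) + 𝟙 (p ∣? x))            ≡⟨ ∑-cong p (λ x _ → 𝟙-¬ (p ∣? x)) ⟩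
    ∑[ _ < p ] 1                                          ≡⟨ ∑-const p 1 ⟩
    p * 1                                                 ≡⟨ *-identityʳ p ⟩
    p                                                     ≡⟨ m∸n+n≡m (>-nonZero⁻¹ p) ⟨
    p ∸ 1 + 1                                             ∎)
    where open ≡-Reasoning

  completions-∣* : ∀ a b → p ∣ a * b → completions a b ≡ 0
  completions-∣* a b p∣ab =
    trans (∑-cong p (λ c _ → 𝟙-no (good₃? a b c) (λ g → proj₁ g (∣m⇒∣m*n c p∣ab)))) (∑-0 p)

  completions-∣+ : ∀ a b → ¬ p ∣ a → ¬ p ∣ b → p ∣ a + b → completions a b ≡ p ∸ 1
  completions-∣+ a b ¬p∣a ¬p∣b p∣a+b =
    trans (∑-cong p (λ c _ → 𝟙-cong (good₃? a b c) (¬? (p ∣? c)) (good₃⇔¬∣ c))) ∑-¬∣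
    where
    good₃⇔¬∣ : ∀ c → Good₃ a b c ⇔ (¬ p ∣ c)
    good₃⇔¬∣ c = mk⇔ (λ good → proj₂ (to (¬∣*⇔ {a * b}) (proj₁ good)))
      (λ ¬p∣c → from ¬∣*⇔ (from ¬∣*⇔ (¬p∣a , ¬p∣b) , ¬p∣c) ,
                ¬p∣c ∘ to (∣m⇒∣m+n⇔∣n p∣a+b) ,
                ∣m⇒∣m*n (b + c) (∣m⇒∣m*n (a + c) p∣a+b))

  good₃⇔∣⊎∣ : ∀ {a b} c → ¬ p ∣ a → ¬ p ∣ b → ¬ p ∣ a + b → Good₃ a b c ⇔ (p ∣ a + c ⊎ p ∣ b + c)
  good₃⇔∣⊎∣ {a} {b} c ¬p∣a ¬p∣b ¬p∣a+b = mk⇔ (λ (_ , _ , p∣π) → split p∣π) join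
    where
    split : p ∣ (a + b) * (a + c) * (b + c) → p ∣ a + c ⊎ p ∣ b + c
    split p∣π with euclidsLemma ((a + b) * (a + c)) (b + c) prime p∣π
    ... | inj₂ p∣b+c = inj₂ p∣b+c
    ... | inj₁ p∣[a+b][a+c] =
      [ (λ p∣a+b → contradiction p∣a+b ¬p∣a+b) , inj₁ ] (euclidsLemma (a + b) (a + c) prime p∣[a+b][a+c])
    ¬p∣abc : ¬ p ∣ c → ¬ p ∣ a * b * c
    ¬p∣abc ¬p∣c = from ¬∣*⇔ (from ¬∣*⇔ (¬p∣a , ¬p∣b) , ¬p∣c)
    join : p ∣ a + c ⊎ p ∣ b + c → Good₃ a b c
    join (inj₁ p∣a+c) =
      ¬p∣abc (¬p∣a ∘ from (∣m+n⇒∣m⇔∣n p∣a+c)) ,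
      (λ p∣s → ¬p∣b (to (∣m+n⇒∣m⇔∣n (subst (p ∣_) (+-assoc-comm a b c) p∣s)) p∣a+c)) ,
      ∣m⇒∣m*n (b + c) (∣n⇒∣m*n (a + b) p∣a+c)
      where
      +-assoc-comm : ∀ x y z → x + y + z ≡ x + z + y
      +-assoc-comm = solve-∀
    join (inj₂ p∣b+c) =
      ¬p∣abc (¬p∣b ∘ from (∣m+n⇒∣m⇔∣n p∣b+c)) ,
      (λ p∣s → ¬p∣a (from (∣m+n⇒∣m⇔∣n (subst (p ∣_) (+-assoc a b c) p∣s)) p∣b+c)) ,
      ∣n⇒∣m*n ((a + b) * (a + c)) p∣b+c

  completions-diag : ∀ a → ¬ p ∣ a → ¬ p ∣ a + a → completions a a ≡ 1
  completions-diag a ¬p∣a ¬p∣a+a = trans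
    (∑-cong p (λ c _ → 𝟙-cong (good₃? a a c) (p ∣? a + c) (mk⇔ reduce inj₁ ⇔-∘ good₃⇔∣⊎∣ c ¬p∣a ¬p∣a ¬p∣a+a)))
    (∑-𝟙-∣+ a)

  completions-off : ∀ a b → a < p → b < p → ¬ p ∣ a → ¬ p ∣ b → ¬ p ∣ a + b → a ≢ b →
                    completions a b ≡ 2
  completions-off a b a<p b<p ¬p∣a ¬p∣b ¬p∣a+b a≢b = begin
    ∑[ c < p ] 𝟙 (good₃? a b c)                       ≡⟨ ∑-cong p (λ c _ → trans
                                                           (𝟙-cong (good₃? a b c) _ (good₃⇔∣⊎∣ c ¬p∣a ¬p∣b ¬p∣a+b))
                                                           (𝟙-⊎ (p ∣? a + c) (p ∣? b + c) (disjoint c))) ⟩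
    ∑[ c < p ] (𝟙 (p ∣? a + c) + 𝟙 (p ∣? b + c))      ≡⟨ ∑-distrib-+ p (λ c → 𝟙 (p ∣? a + c)) (λ c → 𝟙 (p ∣? b + c)) ⟩
    ∑[ c < p ] 𝟙 (p ∣? a + c) + ∑[ c < p ] 𝟙 (p ∣? b + c) ≡⟨ cong₂ _+_ (∑-𝟙-∣+ a) (∑-𝟙-∣+ b) ⟩
    2                                                 ∎
    where
    open ≡-Reasoning
    disjoint : ∀ c → ¬ (p ∣ a + c × p ∣ b + c)
    disjoint c (p∣a+c , p∣b+c) =
      a≢b (∣+-unique a<p b<p (subst (p ∣_) (+-comm a c) p∣a+c) (subst (p ∣_) (+-comm b c) p∣b+c))

  ¬∣m⇒¬∣m+m : 3 ≤ p → ∀ {a} → ¬ p ∣ a → ¬ p ∣ a + a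
  ¬∣m⇒¬∣m+m 3≤p {a} ¬p∣a p∣a+a =
    [ (λ p∣2 → <⇒≱ 3≤p (∣⇒≤ p∣2)) , ¬p∣a ] (euclidsLemma 2 a prime (subst (p ∣_) a+a≡2*a p∣a+a))
    where
    a+a≡2*a : a + a ≡ 2 * a
    a+a≡2*a = cong (a +_) (sym (+-identityʳ a))

  -- The indicator terms bring the four cases b ≡ 0, -a, a, other to one shape, so that the
  -- sum over b needs no subtraction.
  completions-balance : 3 ≤ p → ∀ {a} → ¬ p ∣ a → a < p → ∀ b → b < p →
    completions a b + 𝟙 (b ≟ a) + 2 * 𝟙 (p ∣? b) + 2 * 𝟙 (p ∣? a + b) ≡ 2 + (p ∸ 1) * 𝟙 (p ∣? a + b)
  completions-balance 3≤p {a} ¬p∣a a<p b b<p with p ∣? b | p ∣? a + b | b ≟ a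
  ... | yes p∣b | yes p∣a+b | _        = contradiction (from (∣m+n⇒∣m⇔∣n p∣a+b) p∣b) ¬p∣a
  ... | yes p∣b | no _      | yes refl = contradiction p∣b ¬p∣a
  ... | yes p∣b | no _      | no _     = first-summand (completions-∣* a b (∣n⇒∣m*n a p∣b)) (2≡2+x*0 (p ∸ 1))
  ... | no _    | yes p∣a+b | yes refl = contradiction p∣a+b (¬∣m⇒¬∣m+m 3≤p ¬p∣a)
  ... | no ¬p∣b | yes p∣a+b | no _     = first-summand (completions-∣+ a b ¬p∣a ¬p∣b p∣a+b) (x+0+2*0+2*1≡2+x*1 (p ∸ 1))
  ... | no ¬p∣b | no ¬p∣a+b | yes refl = first-summand (completions-diag a ¬p∣a ¬p∣a+b) (2≡2+x*0 (p ∸ 1))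
  ... | no ¬p∣b | no ¬p∣a+b | no b≢a   = first-summand (completions-off a b a<p b<p ¬p∣a ¬p∣b ¬p∣a+b (b≢a ∘ sym)) (2≡2+x*0 (p ∸ 1))

  ∑-completions : 3 ≤ p → ∀ {a} → ¬ p ∣ a → a < p → ∑[ b < p ] completions a b ≡ 3 * (p ∸ 2)
  ∑-completions 3≤p {a} ¬p∣a a<p = balance-arith p S (<⇒≤ 3≤p) (begin
    S + 1 + 2 * 1 + 2 * 1                                              ≡⟨ lhs ⟨
    ∑[ b < p ] (completions a b + isA b + 2 * isZero b + 2 * isNegA b)  ≡⟨ ∑-cong p (completions-balance 3≤p ¬p∣a a<p) ⟩
    ∑[ b < p ] (2 + (p ∸ 1) * isNegA b)                                ≡⟨ rhs ⟩
    p * 2 + (p ∸ 1) * 1                                                ∎)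
    where
    open ≡-Reasoning
    S : ℕ
    S = ∑[ b < p ] completions a b
    isA isZero isNegA : ℕ → ℕ
    isA b = 𝟙 (b ≟ a)
    isZero b = 𝟙 (p ∣? b)
    isNegA b = 𝟙 (p ∣? a + b)
    lhs : ∑[ b < p ] (completions a b + isA b + 2 * isZero b + 2 * isNegA b) ≡ S + 1 + 2 * 1 + 2 * 1
    lhs = begin
      ∑[ b < p ] (completions a b + isA b + 2 * isZero b + 2 * isNegA b)
        ≡⟨ ∑-distrib-+ p _ (λ b → 2 * isNegA b) ⟩
      ∑[ b < p ] (completions a b + isA b + 2 * isZero b) + ∑[ b < p ] (2 * isNegA b)
        ≡⟨ cong₂ _+_ (∑-distrib-+ p _ (λ b → 2 * isZero b)) (*-distribˡ-∑ p 2 isNegA) ⟩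
      ∑[ b < p ] (completions a b + isA b) + ∑[ b < p ] (2 * isZero b) + 2 * ∑< p isNegA
        ≡⟨ cong₂ (λ u v → u + v + 2 * ∑< p isNegA) (∑-distrib-+ p (completions a) isA) (*-distribˡ-∑ p 2 isZero) ⟩
      S + ∑< p isA + 2 * ∑< p isZero + 2 * ∑< p isNegA
        ≡⟨ cong₂ (λ u v → S + u + 2 * v + 2 * ∑< p isNegA) (∑-𝟙-≟ p a a<p) (∑-𝟙-∣+ 0) ⟩
      S + 1 + 2 * 1 + 2 * ∑< p isNegA
        ≡⟨ cong (λ w → S + 1 + 2 * 1 + 2 * w) (∑-𝟙-∣+ a) ⟩
      S + 1 + 2 * 1 + 2 * 1
        ∎
    rhs : ∑[ b < p ] (2 + (p ∸ 1) * isNegA b) ≡ p * 2 + (p ∸ 1) * 1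
    rhs = trans (∑-distrib-+ p (λ _ → 2) (λ b → (p ∸ 1) * isNegA b))
                (cong₂ _+_ (∑-const p 2) (trans (*-distribˡ-∑ p (p ∸ 1) isNegA) (cong ((p ∸ 1) *_) (∑-𝟙-∣+ a))))

  residueCount-odd : 3 ≤ p → residueCount ≡ 3 * (p ∸ 2) * (p ∸ 1)
  residueCount-odd 3≤p = begin
    residueCount                                  ≡⟨ ∑-cong p (λ a _ → ∑-cong p (λ b _ → ∑-cong p (λ c _ → ∑-good₄ a b c))) ⟩
    ∑[ a < p ] ∑[ b < p ] completions a b         ≡⟨ ∑-cong p ∑-completions-𝟙 ⟩
    ∑[ a < p ] (3 * (p ∸ 2) * 𝟙 (¬? (p ∣? a)))   ≡⟨ *-distribˡ-∑ p (3 * (p ∸ 2)) (λ a → 𝟙 (¬? (p ∣? a))) ⟩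
    3 * (p ∸ 2) * ∑[ a < p ] 𝟙 (¬? (p ∣? a))     ≡⟨ cong (3 * (p ∸ 2) *_) ∑-¬∣ ⟩
    3 * (p ∸ 2) * (p ∸ 1)                         ∎
    where
    open ≡-Reasoning
    ∑-completions-𝟙 : ∀ a → a < p → ∑[ b < p ] completions a b ≡ 3 * (p ∸ 2) * 𝟙 (¬? (p ∣? a))
    ∑-completions-𝟙 a a<p with p ∣? a
    ... | yes p∣a = trans (∑-cong p (λ b _ → completions-∣* a b (∣m⇒∣m*n b p∣a)))
                          (trans (∑-0 p) (sym (*-zeroʳ (3 * (p ∸ 2)))))
    ... | no ¬p∣a = trans (∑-completions 3≤p ¬p∣a a<p) (sym (*-identityʳ (3 * (p ∸ 2))))

  M-reduction : ∀ k → M p (suc k) ≡ p ^ (4 * k) * residueCount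
  M-reduction k = begin
    M p (suc k)                                             ≡⟨ length-filter≡sum-𝟙 (cond? p (suc k)) (quads (p * p ^ k)) ⟩
    sum (map count (quads (p * p ^ k)))                     ≡⟨ cong (sum ∘ map count ∘ quads) (*-comm p (p ^ k)) ⟩
    sum (map count (quads (p ^ k * p)))                     ≡⟨ sum-map-quads-periodic (p ^ k) count _
                                                                 (λ a b c d → 𝟙-cong _ _ (cond⇔good₄ k a b c d)) ⟩
    (p ^ k) ^ 4 * residueCount                              ≡⟨ cong (_* residueCount)
                                                                 (trans (^-*-assoc p k 4) (cong (p ^_) (*-comm k 4))) ⟩
    p ^ (4 * k) * residueCount                              ∎
    where
    open ≡-Reasoning
    count : Quad → ℕ
    count = 𝟙 ∘ cond? p (suc k)

x*[3*v*u]≡3*x*u*v : ∀ x u v → x * (3 * v * u) ≡ 3 * x * u * v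
x*[3*v*u]≡3*x*u*v = solve-∀

mainTheorem16 : (p k : ℕ) → (pr : Prime p) → k ≥ 1 →
    ((p ≡ 2 → M p k {{prime⇒nonZero pr}} ≡ 2 ^ (4 * (k ∸ 1))) ×
     (p ≥ 3 → M p k {{prime⇒nonZero pr}} ≡ 3 * p ^ (4 * (k ∸ 1)) * (p ∸ 1) * (p ∸ 2)))
mainTheorem16 p (suc k) pr (s≤s z≤n) = even , odd
  where
  even : p ≡ 2 → M p (suc k) {{prime⇒nonZero pr}} ≡ 2 ^ (4 * k)
  even refl = trans (M-reduction pr k) (trans (cong (2 ^ (4 * k) *_) residueCount[2]≡1) (*-identityʳ _))
  odd : p ≥ 3 → M p (suc k) {{prime⇒nonZero pr}} ≡ 3 * p ^ (4 * k) * (p ∸ 1) * (p ∸ 2)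
  odd 3≤p = trans (M-reduction pr k)
    (trans (cong (p ^ (4 * k) *_) (residueCount-odd pr 3≤p)) (x*[3*v*u]≡3*x*u*v (p ^ (4 * k)) (p ∸ 1) (p ∸ 2)))
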